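{- Let $k\ge1$ and consider $k$-pile Nim as a directed graph $G$ whose vertices are the $k$-tuples $(n_1,\dots,n_k)$ of nonnegative integers and whose edges go from $(n_1,\dots,n_k)$ to every tuple obtained by replacing exactly one coordinate $n_i$ by some integer $m$ with $0\le m<n_i$. Let $\psi$ be the equiprobable move error distribution on $G$: for every non-terminal position $v$ with outdegree $n$, $\psi_v(w,u)=\frac1n$ for all $w,u\in F(v)$. Then for every starting position $v$ that is neither a $P$-position nor an $N$-position of $G_\psi$ (i.e. $N_v\neq 0,1$), the game $G_\psi$ is a fair chance game, i.e. $N_v=\frac12$.
   Context: For a position $v$, $F(v)$ is its set of followers (positions reachable in one move); $v$ is terminal if $F(v)=\emptyset$ (here, the all-zero tuple). A move error distribution assigns to each $v$ and $w,u\in F(v)$ the probability $\psi_v(w,u)$ that, at $v$, a player who sends the move to $w$ actually has the move to $u$ played. The game $G_\psi$: two players alternate moves from the starting position; at $v$ the player to move chooses $w\in F(v)$ and the position reached is $u$ with probability $\psi_v(w,u)$; a player facing a terminal position on their turn loses. The winning probability of the player to move at $v$ under optimal play is defined recursively by $N_v=0$ if $v$ is terminal and otherwise $N_v=\max_{w\in F(v)}\sum_{u\in F(v)}(1-N_u)\,\psi_v(w,u)$. A position $v$ is a $P$-position if $N_v=0$ and an $N$-position if $N_v=1$. -}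

module Defs where

open import Data.Nat as ℕ using (ℕ; zero; suc)
open import Data.Fin using (Fin)
open import Data.Vec using (Vec; lookup; _[_]≔_; allFin; toList)
open import Data.List using (List; []; _∷_; concatMap; map; upTo; length; foldr)
open import Data.Integer using (+_)
open import Data.Rational using (ℚ; 0ℚ; 1ℚ; _+_; _-_; _*_; _⊔_; _/_)

Pos : ℕ → Set
Pos k = Vec ℕ k

-- F(v): all tuples obtained by replacing exactly one coordinate n_i by m with 0 ≤ m < n_i.
-- (This list has no duplicates, so it represents the follower set.)
followers : ∀ {k} → Pos k → List (Pos k)
followers {k} v =
  concatMap (λ i → map (λ m → v [ i ]≔ m) (upTo (lookup v i))) (toList (allFin k))

-- Equiprobable move error distribution: ψ_v(w,u) = 1 / |F(v)| (v non-terminal).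
-- (For terminal v it is never used; we set it to 0.)
ψ : ∀ {k} → Pos k → Pos k → Pos k → ℚ
ψ v w u with followers v
... | [] = 0ℚ
... | _ ∷ xs = + 1 / suc (length xs)

sumℚ : List ℚ → ℚ
sumℚ = foldr _+_ 0ℚ

maxℚ : ℚ → List ℚ → ℚ
maxℚ x xs = foldr _⊔_ x xs

-- Every move decreases the coordinate sum by at least one, so fuel = (sum v) + 1 suffices.
Nfuel : ∀ {k} → ℕ → Pos k → ℚ
Nfuel zero v = 0ℚ
Nfuel (suc f) v with followers v
... | [] = 0ℚ
... | w₀ ∷ ws =
  maxℚ (val w₀) (map val ws)
  where
    Fv : List _
    Fv = w₀ ∷ ws
    val : _ → ℚ
    val w = sumℚ (map (λ u → (1ℚ - Nfuel f u) * ψ v w u) Fv)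

Nval : ∀ {k} → Pos k → ℚ
Nval v = Nfuel (suc (Data.Vec.sum v)) v

-- A position all of whose piles are 0 or 1 is ordinary Nim: the player to move
-- wins surely if the number of 1-piles is odd and loses surely if it is even.
-- Every other position has value ½. Because ψ is uniform, N_v does not depend on
-- the chosen move: it is the mean of 1 − N_u over the followers u. So it suffices
-- that this mean reproduces the predicted value of v, which follows by induction
-- on the piles: once some pile n is at least 2, reducing it to 0 and to 1 gives
-- two followers of complementary value, and every other follower still has a
-- pile at least 2, hence value ½.
module Submission where

open import Defs
open import Data.Nat using (ℕ; suc)
open import Data.Rational using (0ℚ; 1ℚ; ½)
open import Relation.Binary.PropositionalEquality using (_≡_; _≢_)

open import Data.Nat as ℕ using (zero; _<_)
import Data.Nat.Properties as ℕ
import Data.Nat.Coprimality as Coprime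
import Data.Fin as Fin
open import Data.Vec as Vec using ([]; _∷_; _[_]≔_; allFin; toList)
import Data.Vec.Properties as Vec
open import Data.List using (List; []; _∷_; map; upTo; applyUpTo; length; concatMap; _++_)
import Data.List.Properties as List
open import Data.List.Relation.Unary.All as All using (All; []; _∷_)
import Data.List.Relation.Unary.All.Properties as All
import Data.Integer as ℤ
import Data.Integer.Properties as ℤ
open import Data.Rational using (ℚ; mkℚ; _+_; _-_; _*_; _⊔_; _/_)
import Data.Rational.Properties as ℚ
open import Data.Empty using (⊥-elim)
open import Function using (_∘_; const)
open import Relation.Binary.PropositionalEquality
  using (refl; sym; trans; cong; cong₂; subst; module ≡-Reasoning)

fromℕ : ℕ → ℚ
fromℕ n = mkℚ (ℤ.+ n) 0 (Coprime.sym (Coprime.1-coprimeTo n))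

fromℕ-suc : ∀ n → fromℕ (suc n) ≡ 1ℚ + fromℕ n
fromℕ-suc n = sym (trans
  (ℚ./-cong {p₁ = ℤ.+ 1 ℤ.+ ℤ.+ n ℤ.* ℤ.+ 1} {q₁ = 1} {p₂ = ℤ.+ suc n} {q₂ = 1}
    (cong (λ z → ℤ.+ 1 ℤ.+ z) (ℤ.*-identityʳ (ℤ.+ n))) refl)
  (ℚ.normalize-coprime (Coprime.sym (Coprime.1-coprimeTo (suc n)))))

fromℕ-suc-*-inverse : ∀ n → fromℕ (suc n) * (ℤ.+ 1 / suc n) ≡ 1ℚ
fromℕ-suc-*-inverse n =
  trans (cong (fromℕ (suc n) *_) (ℚ.normalize-coprime (Coprime.1-coprimeTo (suc n))))
        (ℚ.*-inverseʳ (fromℕ (suc n)))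

sumℚ-cong : {A : Set} {f g : A → ℚ} {xs : List A} → All (λ x → f x ≡ g x) xs →
  sumℚ (map f xs) ≡ sumℚ (map g xs)
sumℚ-cong [] = refl
sumℚ-cong (p ∷ ps) = cong₂ _+_ p (sumℚ-cong ps)

sumℚ-map : {A B : Set} (f : B → ℚ) (h : A → B) (xs : List A) →
  sumℚ (map f (map h xs)) ≡ sumℚ (map (f ∘ h) xs)
sumℚ-map f h xs = cong sumℚ (sym (List.map-∘ xs))

sumℚ-*ʳ : {A : Set} (f : A → ℚ) (c : ℚ) (xs : List A) →
  sumℚ (map (λ x → f x * c) xs) ≡ sumℚ (map f xs) * c
sumℚ-*ʳ f c [] = sym (ℚ.*-zeroˡ c)
sumℚ-*ʳ f c (x ∷ xs) = trans (cong ((f x * c) +_) (sumℚ-*ʳ f c xs))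
  (sym (ℚ.*-distribʳ-+ c (f x) (sumℚ (map f xs))))

sumℚ-const : {A : Set} (a : ℚ) (xs : List A) → sumℚ (map (const a) xs) ≡ fromℕ (length xs) * a
sumℚ-const a [] = sym (ℚ.*-zeroˡ a)
sumℚ-const a (x ∷ xs) = begin
  a + sumℚ (map (const a) xs)      ≡⟨ cong₂ _+_ (sym (ℚ.*-identityˡ a)) (sumℚ-const a xs) ⟩
  1ℚ * a + fromℕ (length xs) * a   ≡⟨ ℚ.*-distribʳ-+ a 1ℚ (fromℕ (length xs)) ⟨
  (1ℚ + fromℕ (length xs)) * a     ≡⟨ cong (_* a) (fromℕ-suc (length xs)) ⟨
  fromℕ (suc (length xs)) * a      ∎
  where open ≡-Reasoning

mean-const : {A : Set} (a : ℚ) (x : A) (xs : List A) →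
  sumℚ (map (const a) (x ∷ xs)) * (ℤ.+ 1 / suc (length xs)) ≡ a
mean-const a x xs = begin
  sumℚ (map (const a) (x ∷ xs)) * c   ≡⟨ cong (_* c) (sumℚ-const a (x ∷ xs)) ⟩
  (fromℕ (suc (length xs)) * a) * c   ≡⟨ cong (_* c) (ℚ.*-comm _ a) ⟩
  (a * fromℕ (suc (length xs))) * c   ≡⟨ ℚ.*-assoc a _ c ⟩
  a * (fromℕ (suc (length xs)) * c)   ≡⟨ cong (a *_) (fromℕ-suc-*-inverse (length xs)) ⟩
  a * 1ℚ                              ≡⟨ ℚ.*-identityʳ a ⟩
  a                                   ∎
  where
    open ≡-Reasoning
    c : ℚ
    c = ℤ.+ 1 / suc (length xs)

maxℚ-const : {A : Set} (f : A → ℚ) (a : ℚ) (xs : List A) → (∀ x → f x ≡ a) →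
  maxℚ a (map f xs) ≡ a
maxℚ-const f a [] f≡a = refl
maxℚ-const f a (x ∷ xs) f≡a = trans (cong₂ _⊔_ (f≡a x) (maxℚ-const f a xs f≡a)) (ℚ.⊔-idem a)

followers-∷ : ∀ {k} (x : ℕ) (v : Pos k) →
  followers (x ∷ v) ≡ map (_∷ v) (upTo x) ++ map (x ∷_) (followers v)
followers-∷ {k} x v = cong (map (_∷ v) (upTo x) ++_) (begin
  concatMap moves (toList (Vec.tabulate Fin.suc))
    ≡⟨ cong (concatMap moves ∘ toList) (Vec.tabulate-allFin Fin.suc) ⟩
  concatMap moves (toList (Vec.map Fin.suc (allFin k)))
    ≡⟨ cong (concatMap moves) (Vec.toList-map Fin.suc (allFin k)) ⟩
  concatMap moves (map Fin.suc (toList (allFin k)))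
    ≡⟨ List.concatMap-map moves Fin.suc (toList (allFin k)) ⟩
  concatMap (moves ∘ Fin.suc) (toList (allFin k))
    ≡⟨ List.concatMap-cong (λ i → List.map-∘ (upTo (Vec.lookup v i))) (toList (allFin k)) ⟩
  concatMap (map (x ∷_) ∘ movesᵥ) (toList (allFin k))
    ≡⟨ List.map-concatMap (x ∷_) movesᵥ (toList (allFin k)) ⟨
  map (x ∷_) (followers v)
    ∎)
  where
    open ≡-Reasoning
    moves : Fin.Fin (suc k) → List (Pos (suc k))
    moves i = map (λ m → (x ∷ v) [ i ]≔ m) (upTo (Vec.lookup (x ∷ v) i))
    movesᵥ : Fin.Fin k → List (Pos k)
    movesᵥ i = map (λ m → v [ i ]≔ m) (upTo (Vec.lookup v i))

data Outcome : Set where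
  P N fair : Outcome

swapPN : Outcome → Outcome
swapPN P = N
swapPN N = P
swapPN fair = fair

swapPN-involutive : ∀ o → swapPN (swapPN o) ≡ o
swapPN-involutive P = refl
swapPN-involutive N = refl
swapPN-involutive fair = refl

outcome : ∀ {k} → Pos k → Outcome
outcome [] = P
outcome (zero ∷ v) = outcome v
outcome (suc zero ∷ v) = swapPN (outcome v)
outcome (suc (suc _) ∷ v) = fair

winProb : Outcome → ℚ
winProb P = 0ℚ
winProb N = 1ℚ
winProb fair = ½

1-winProb-swapPN : ∀ o → 1ℚ - winProb (swapPN o) ≡ winProb o
1-winProb-swapPN P = refl
1-winProb-swapPN N = refl
1-winProb-swapPN fair = refl

Balanced : (Outcome → ℚ) → Set
Balanced g = ∀ o → g o + g (swapPN o) ≡ g fair + g fair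

balanced-∘-swapPN : ∀ g → Balanced g → Balanced (g ∘ swapPN)
balanced-∘-swapPN g bal o =
  trans (cong (g (swapPN o) +_) (cong g (swapPN-involutive o))) (trans (ℚ.+-comm _ (g o)) (bal o))

balanced-1-winProb : Balanced (λ o → 1ℚ - winProb o)
balanced-1-winProb P = refl
balanced-1-winProb N = refl
balanced-1-winProb fair = refl

sumℚ-followers : ∀ g → Balanced g → ∀ {k} (v : Pos k) →
  sumℚ (map (g ∘ outcome) (followers v)) ≡ sumℚ (map (const (g (swapPN (outcome v)))) (followers v))
sumℚ-followers g bal [] = refl
sumℚ-followers g bal (x ∷ v) rewrite followers-∷ x v = moves x
  where
    Fv : List (Pos _)
    Fv = followers v

    prependPile : (y : ℕ) {f : Pos _ → ℚ} {a : ℚ} →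
      sumℚ (map (f ∘ (y ∷_)) Fv) ≡ sumℚ (map (const a) Fv) →
      sumℚ (map f (map (y ∷_) Fv)) ≡ sumℚ (map (const a) (map (y ∷_) Fv))
    prependPile y {f} {a} eq = trans (sumℚ-map f (y ∷_) Fv)
      (trans eq (sym (sumℚ-map (const a) (y ∷_) Fv)))

    moves : (x : ℕ) →
      sumℚ (map (g ∘ outcome) (map (_∷ v) (upTo x) ++ map (x ∷_) Fv))
      ≡ sumℚ (map (const (g (swapPN (outcome (x ∷ v))))) (map (_∷ v) (upTo x) ++ map (x ∷_) Fv))
    moves zero = prependPile zero (sumℚ-followers g bal v)
    moves (suc zero) = cong₂ _+_ (cong g (sym (swapPN-involutive (outcome v))))
      (prependPile 1 (sumℚ-followers (g ∘ swapPN) (balanced-∘-swapPN g bal) v))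
    moves (suc (suc y)) = begin
      g o + (g (swapPN o) + sumℚ (map (g ∘ outcome) R))  ≡⟨ ℚ.+-assoc (g o) _ _ ⟨
      (g o + g (swapPN o)) + sumℚ (map (g ∘ outcome) R)  ≡⟨ cong₂ _+_ (bal o) (sumℚ-cong R-fair) ⟩
      (g fair + g fair) + sumℚ (map (const (g fair)) R)  ≡⟨ ℚ.+-assoc (g fair) _ _ ⟩
      g fair + (g fair + sumℚ (map (const (g fair)) R))  ∎
      where
        open ≡-Reasoning
        o : Outcome
        o = outcome v
        R : List (Pos _)
        R = map (_∷ v) (applyUpTo (suc ∘ suc) y) ++ map (suc (suc y) ∷_) Fv
        R-fair : All (λ u → g (outcome u) ≡ g fair) R
        R-fair = All.++⁺ (All.map⁺ (All.applyUpTo⁺₂ _ y (λ _ → refl)))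
                         (All.map⁺ (All.universal (λ _ → refl) Fv))

outcome-terminal : ∀ {k} (v : Pos k) → followers v ≡ [] → outcome v ≡ P
outcome-terminal [] _ = refl
outcome-terminal (zero ∷ v) noMoves with followers v in eq | trans (sym (followers-∷ zero v)) noMoves
... | [] | _ = outcome-terminal v eq
outcome-terminal (suc x ∷ v) noMoves with trans (sym (followers-∷ (suc x) v)) noMoves
... | ()

followers-sum-< : ∀ {k} (v : Pos k) → All (λ u → Vec.sum u < Vec.sum v) (followers v)
followers-sum-< [] = []
followers-sum-< (x ∷ v) rewrite followers-∷ x v =
  All.++⁺ (All.map⁺ (All.applyUpTo⁺₁ _ x (ℕ.+-monoˡ-< (Vec.sum v))))
          (All.map⁺ (All.map (ℕ.+-monoʳ-< x) (followers-sum-< v)))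

ψ-uniform : ∀ {k} {v w₀ : Pos k} {ws : List (Pos k)} → followers v ≡ w₀ ∷ ws →
  ∀ w u → ψ v w u ≡ ℤ.+ 1 / suc (length ws)
ψ-uniform {v = v} eq w u with followers v
ψ-uniform refl w u | _ = refl

Nfuel≡winProb∘outcome : ∀ {k} (f : ℕ) (v : Pos k) → Vec.sum v < f → Nfuel f v ≡ winProb (outcome v)
Nfuel≡winProb∘outcome (suc f) v sum<f with followers v in eq
... | [] = cong winProb (sym (outcome-terminal v eq))
... | w₀ ∷ ws = trans (cong (λ a → maxℚ a (map value ws)) (value≡ w₀)) (maxℚ-const value _ ws value≡)
  where
    Fv : List (Pos _)
    Fv = w₀ ∷ ws
    c : ℚ
    c = ℤ.+ 1 / suc (length ws)
    o : Outcome
    o = outcome v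
    value : Pos _ → ℚ
    value w = sumℚ (map (λ u → (1ℚ - Nfuel f u) * ψ v w u) Fv)

    Nfuel-followers : All (λ u → Nfuel f u ≡ winProb (outcome u)) Fv
    Nfuel-followers = All.map (λ u< → Nfuel≡winProb∘outcome f _ (ℕ.<-≤-trans u< (ℕ.≤-pred sum<f)))
      (subst (All _) eq (followers-sum-< v))

    mean-over-followers : sumℚ (map (λ u → 1ℚ - winProb (outcome u)) Fv)
                        ≡ sumℚ (map (const (1ℚ - winProb (swapPN o))) Fv)
    mean-over-followers = subst (λ L → sumℚ (map (λ u → 1ℚ - winProb (outcome u)) L)
                                     ≡ sumℚ (map (const (1ℚ - winProb (swapPN o))) L))
      eq (sumℚ-followers (λ o → 1ℚ - winProb o) balanced-1-winProb v)

    value≡ : ∀ w → value w ≡ winProb o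
    value≡ w = begin
      value w
        ≡⟨ sumℚ-cong (All.map (λ {u} Nu≡ → cong₂ _*_ (cong (1ℚ -_) Nu≡) (ψ-uniform eq w u))
                              Nfuel-followers) ⟩
      sumℚ (map (λ u → (1ℚ - winProb (outcome u)) * c) Fv)
        ≡⟨ sumℚ-*ʳ (λ u → 1ℚ - winProb (outcome u)) c Fv ⟩
      sumℚ (map (λ u → 1ℚ - winProb (outcome u)) Fv) * c
        ≡⟨ cong (_* c) mean-over-followers ⟩
      sumℚ (map (const (1ℚ - winProb (swapPN o))) Fv) * c
        ≡⟨ mean-const _ w₀ ws ⟩
      1ℚ - winProb (swapPN o)
        ≡⟨ 1-winProb-swapPN o ⟩
      winProb o
        ∎
      where open ≡-Reasoning

mainTheorem3 : (k : ℕ) → (v : Pos (suc k)) →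
    Nval v ≢ 0ℚ → Nval v ≢ 1ℚ → Nval v ≡ ½
mainTheorem3 k v Nv≢0 Nv≢1 with outcome v | Nfuel≡winProb∘outcome (suc (Vec.sum v)) v ℕ.≤-refl
... | P | Nv≡0 = ⊥-elim (Nv≢0 Nv≡0)
... | N | Nv≡1 = ⊥-elim (Nv≢1 Nv≡1)
... | fair | Nv≡½ = Nv≡½
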